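{- Let $n\geq 1$ and let $\lambda$ be an edge $n$-colouring of the complete graph on a set $B$ whose induced map $X\mapsto\bigcup_{a\in X}\lambda^{ -1}(a)$ is a qualitative representation of $\mathfrak{E}^{\{2\}}_{n+1}$. Let $v_0\in B$ be chromatically saturated (for every $c_i\in C$ there is $w\in B$ with $\lambda(v_0,w)=c_i$), and for each $i\in\{1,\dots,n\}$ choose $v_i\in B$ with $\lambda(v_0,v_i)=c_i$. Define a relation $\sqsubset$ on $\{v_0,\dots,v_n\}$ by $v_i\sqsubset v_j$ iff $\lambda(v_i,v_j)=c_j$ (where for $j=0$ this never holds, as $c_0$ is not a colour). Then $\sqsubset$ is a strict linear order on $\{v_0,\dots,v_n\}$.
   Context: Let $C=\{c_1,\dots,c_n\}$ (proper colours) and $C^+=\{1'\}\cup C$. An edge $n$-colouring of the complete graph on $U$ is a surjective map $\lambda\colon U\times U\to C^+$ with $\lambda(x,y)=\lambda(y,x)$ and $\lambda(x,y)=1'$ iff $x=y$. The chromatic algebra $\mathfrak{E}^{\{2\}}_{n+1}$: a triple $(x,y,z)\in (C^+)^3$ is consistent if either one of $x,y,z$ equals $1'$ and the other two are equal, or $x,y,z\in C$ and $|\{x,y,z\}|=2$. The algebra has universe the power set of $C^+$, set-theoretic Boolean operations ($0=\varnothing$, $1=C^+$), identity $\{1'\}$, converse the identity map, and composition $X;Y=\{z:(x,y,z)\text{ consistent for some }x\in X,y\in Y\}$; $\leq$ is inclusion. A qualitative representation of $\mathbf A$ on a set $U$ is an injective Boolean algebra homomorphism $\varphi$ from $\mathbf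 A$ into the power set of $U\times U$ with $\varphi(0)=\varnothing$, $\varphi(1)=U\times U$, $\varphi(1')=\mathrm{Id}_U$, $\varphi(\breve x)=\varphi(x)^{\smile}$, and $\varphi(x)\circ\varphi(y)\subseteq\varphi(z)$ iff $x;y\leq z$ for all $x,y,z$ ($\circ$ relational composition). -}

module Defs where

open import Data.Nat using (ℕ; zero; suc)
open import Data.Fin using (Fin; zero; suc)
open import Data.Fin.Subset using (Subset; _∈_; _∪_; _∩_; ∁; ⊥; ⊤; ⁅_⁆)
open import Data.Product using (Σ; ∃; _×_; _,_)
open import Data.Sum using (_⊎_)
open import Relation.Binary.PropositionalEquality using (_≡_; _≢_)
open import Relation.Nullary using (¬_)
open import Function.Bundles using (_⇔_)

-- Colours.  C⁺ = Fin (suc n):  zero is the identity 1',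
-- suc i (i : Fin n) is the proper colour c_{i+1}.

Colour⁺ : ℕ → Set
Colour⁺ n = Fin (suc n)

1′ : ∀ {n} → Colour⁺ n
1′ = zero

col : ∀ {n} → Fin n → Colour⁺ n
col i = suc i

TwoDistinct : ∀ {n} → Colour⁺ n → Colour⁺ n → Colour⁺ n → Set
TwoDistinct x y z =
  ((x ≡ y) × (y ≢ z)) ⊎ ((x ≡ z) × (x ≢ y)) ⊎ ((y ≡ z) × (x ≢ y))

Consistent : ∀ {n} → Colour⁺ n → Colour⁺ n → Colour⁺ n → Set
Consistent x y z =
     ((x ≡ 1′) × (y ≡ z))
  ⊎ ((y ≡ 1′) × (x ≡ z))
  ⊎ ((z ≡ 1′) × (x ≡ y))
  ⊎ ((x ≢ 1′) × (y ≢ 1′) × (z ≢ 1′) × TwoDistinct x y z)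

-- The chromatic algebra: universe = Subset (suc n) (power set of C⁺),
-- Boolean operations from Data.Fin.Subset, identity ⁅ 1′ ⁆,
-- converse = identity map, composition given by consistent triples.

Elt : ℕ → Set
Elt n = Subset (suc n)

_∈_⨾_ : ∀ {n} → Colour⁺ n → Elt n → Elt n → Set
z ∈ X ⨾ Y = Σ _ λ x → Σ _ λ y → (x ∈ X) × (y ∈ Y) × Consistent x y z

_⨾_≤_ : ∀ {n} → Elt n → Elt n → Elt n → Set
X ⨾ Y ≤ Z = ∀ z → z ∈ X ⨾ Y → z ∈ Z

conv : ∀ {n} → Elt n → Elt n
conv X = X

BRel : Set → Set₁
BRel U = U → U → Set

_≐_ : ∀ {U} → BRel U → BRel U → Set
R ≐ S = ∀ x y → R x y ⇔ S x y

_⊆ᵣ_ : ∀ {U} → BRel U → BRel U → Set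
R ⊆ᵣ S = ∀ x y → R x y → S x y

_∪ᵣ_ _∩ᵣ_ _∘ᵣ_ : ∀ {U} → BRel U → BRel U → BRel U
(R ∪ᵣ S) x y = R x y ⊎ S x y
(R ∩ᵣ S) x y = R x y × S x y
(R ∘ᵣ S) x z = ∃ λ y → R x y × S y z

∁ᵣ : ∀ {U} → BRel U → BRel U
∁ᵣ R x y = ¬ R x y

∅ᵣ Fullᵣ Idᵣ : ∀ {U} → BRel U
∅ᵣ x y = Data.Empty.⊥ where import Data.Empty
Fullᵣ x y = Data.Unit.⊤ where import Data.Unit
Idᵣ x y = x ≡ y

_˘ : ∀ {U} → BRel U → BRel U
(R ˘) x y = R y x

record IsQualRep {n : ℕ} (U : Set) (φ : Elt n → BRel U) : Set where
  field
    injective : ∀ X Y → φ X ≐ φ Y → X ≡ Y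
    hom-∪     : ∀ X Y → φ (X ∪ Y) ≐ (φ X ∪ᵣ φ Y)
    hom-∩     : ∀ X Y → φ (X ∩ Y) ≐ (φ X ∩ᵣ φ Y)
    hom-∁     : ∀ X → φ (∁ X) ≐ ∁ᵣ (φ X)
    hom-0     : φ ⊥ ≐ ∅ᵣ
    hom-1     : φ ⊤ ≐ Fullᵣ
    hom-1′    : φ ⁅ 1′ ⁆ ≐ Idᵣ
    hom-conv  : ∀ X → φ (conv X) ≐ (φ X ˘)
    hom-comp  : ∀ X Y Z → ((φ X ∘ᵣ φ Y) ⊆ᵣ φ Z) ⇔ (X ⨾ Y ≤ Z)

record IsEdgeColouring {n : ℕ} (U : Set) (λc : U → U → Colour⁺ n) : Set where
  field
    surjective : ∀ c → ∃ λ x → ∃ λ y → λc x y ≡ c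
    symmetric  : ∀ x y → λc x y ≡ λc y x
    identity   : ∀ x y → (λc x y ≡ 1′) ⇔ (x ≡ y)

induced : ∀ {n} {U : Set} → (U → U → Colour⁺ n) → Elt n → BRel U
induced λc X x y = λc x y ∈ X

Saturated : ∀ {n} {U : Set} → (U → U → Colour⁺ n) → U → Set
Saturated {n} λc v₀ = ∀ (i : Fin n) → ∃ λ w → λc v₀ w ≡ col i

family : ∀ {n} {U : Set} → U → (Fin n → U) → Fin (suc n) → U
family v₀ v zero    = v₀
family v₀ v (suc i) = v i

Sq : ∀ {n} {U : Set} → (U → U → Colour⁺ n) → (Fin (suc n) → U) →
     Fin (suc n) → Fin (suc n) → Set
Sq λc V i zero    = Data.Empty.⊥ where import Data.Empty
Sq λc V i (suc k) = λc (V i) (V (suc k)) ≡ col k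

{-# OPTIONS --safe #-}
module Submission where

-- In a qualitative representation of E^{2}_{n+1} every triangle is coloured by a
-- consistent triple, so no triangle is rainbow.  As v₀ sees v i and v j in the
-- colours c_i and c_j, the edge between v i and v j has colour c_i or c_j, which
-- makes ⊏ total on v₁ … vₙ; a cycle i ⊏ j ⊏ k ⊏ i would be a rainbow triangle,
-- which gives transitivity.  Finally v₀ lies below every v i and above none.

open import Defs
open import Level using (Level)
open import Data.Nat as ℕ using (ℕ; _≤_)
open import Data.Fin using (Fin; zero; suc; _≟_)
open import Data.Fin.Properties using (suc-injective; 0≢1+n)
open import Data.Fin.Subset using (_∈_; ⁅_⁆; ∁)
open import Data.Fin.Subset.Properties using (x∈⁅x⁆; x∈⁅y⁆⇒x≡y; x∉p⇒x∈∁p; x∈∁p⇒x∉p)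
open import Data.Product using (_,_)
open import Data.Sum using (_⊎_; inj₁; inj₂)
open import Data.Empty using (⊥; ⊥-elim)
open import Function using (_∘_; id)
open import Function.Bundles using (_⇔_; mk⇔; Equivalence)
open import Relation.Nullary using (¬_; yes; no)
open import Relation.Binary using (Rel; Transitive; Trichotomous; tri<; tri≈; tri>;
  IsStrictTotalOrder; isStrictTotalOrderᶜ)
open import Relation.Binary.PropositionalEquality
  using (_≡_; _≢_; refl; sym; trans; cong; subst; subst₂; isEquivalence)

private
  variable
    n : ℕ
    ℓ₁ ℓ₂ : Level

distinct⇒¬Consistent : {x y z : Colour⁺ n} → x ≢ y → y ≢ z → x ≢ z → ¬ Consistent x y z
distinct⇒¬Consistent x≢y y≢z x≢z (inj₁ (_ , y≡z))                                         = y≢z y≡z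
distinct⇒¬Consistent x≢y y≢z x≢z (inj₂ (inj₁ (_ , x≡z)))                                  = x≢z x≡z
distinct⇒¬Consistent x≢y y≢z x≢z (inj₂ (inj₂ (inj₁ (_ , x≡y))))                           = x≢y x≡y
distinct⇒¬Consistent x≢y y≢z x≢z (inj₂ (inj₂ (inj₂ (_ , _ , _ , inj₁ (x≡y , _)))))        = x≢y x≡y
distinct⇒¬Consistent x≢y y≢z x≢z (inj₂ (inj₂ (inj₂ (_ , _ , _ , inj₂ (inj₁ (x≡z , _)))))) = x≢z x≡z
distinct⇒¬Consistent x≢y y≢z x≢z (inj₂ (inj₂ (inj₂ (_ , _ , _ , inj₂ (inj₂ (y≡z , _)))))) = y≢z y≡z

col-≢ : {u w : Colour⁺ n} {i j : Fin n} → u ≡ col i → w ≡ col j → i ≢ j → u ≢ w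
col-≢ refl refl i≢j = i≢j ∘ suc-injective

¬Consistent⇒⁅⁆⨾⁅⁆≤∁⁅⁆ : {x y z : Colour⁺ n} → ¬ Consistent x y z → ⁅ x ⁆ ⨾ ⁅ y ⁆ ≤ ∁ ⁅ z ⁆
¬Consistent⇒⁅⁆⨾⁅⁆≤∁⁅⁆ ¬xyz w (x′ , y′ , x′∈ , y′∈ , x′y′w) = x∉p⇒x∈∁p λ w∈ →
  ¬xyz (subst₂ (λ x y → Consistent x y _) (x∈⁅y⁆⇒x≡y _ x′∈) (x∈⁅y⁆⇒x≡y _ y′∈)
          (subst (Consistent _ _) (x∈⁅y⁆⇒x≡y _ w∈) x′y′w))

module _ {U : Set} {λc : U → U → Colour⁺ n} (rep : IsQualRep U (induced λc)) where
  open IsQualRep rep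

  -- Otherwise ⁅ λc x y ⁆ ⨾ ⁅ λc y z ⁆ ≤ ∁ ⁅ λc x z ⁆, and the representation
  -- would put the edge (x , z) outside its own colour.
  triangle-consistent : ∀ x y z → ¬ ¬ Consistent (λc x y) (λc y z) (λc x z)
  triangle-consistent x y z ¬xyz = x∈∁p⇒x∉p xz∈∁ (x∈⁅x⁆ (λc x z))
    where
    xz∈∁ : λc x z ∈ ∁ ⁅ λc x z ⁆
    xz∈∁ = Equivalence.from (hom-comp _ _ _) (¬Consistent⇒⁅⁆⨾⁅⁆≤∁⁅⁆ ¬xyz) x z (y , x∈⁅x⁆ _ , x∈⁅x⁆ _)

  no-rainbow-triangle : ∀ x y z → λc x y ≢ λc y z → λc y z ≢ λc x z → λc x y ≢ λc x z → ⊥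
  no-rainbow-triangle x y z xy≢yz yz≢xz xy≢xz =
    triangle-consistent x y z (distinct⇒¬Consistent xy≢yz yz≢xz xy≢xz)

module _ {R : Rel (Fin n) ℓ₁} {S : Rel (Fin (ℕ.suc n)) ℓ₂}
         (nothing-S-zero : ∀ i → ¬ S i zero) (zero-S-suc : ∀ i → S zero (suc i))
         (S-suc⇔R : ∀ i j → S (suc i) (suc j) ⇔ R i j) where
  private
    module R⇔ (i j : Fin n) = Equivalence (S-suc⇔R i j)

  adjoin-least-trans : Transitive R → Transitive S
  adjoin-least-trans R-trans {_}     {_}     {zero}  _   jSk = ⊥-elim (nothing-S-zero _ jSk)
  adjoin-least-trans R-trans {zero}  {_}     {suc k} _   _   = zero-S-suc k
  adjoin-least-trans R-trans {suc i} {zero}  {suc k} iSj _   = ⊥-elim (nothing-S-zero _ iSj)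
  adjoin-least-trans R-trans {suc i} {suc j} {suc k} iSj jSk =
    R⇔.from i k (R-trans (R⇔.to i j iSj) (R⇔.to j k jSk))

  adjoin-least-compare : Trichotomous _≡_ R → Trichotomous _≡_ S
  adjoin-least-compare R-compare zero    zero    = tri≈ (nothing-S-zero zero) refl (nothing-S-zero zero)
  adjoin-least-compare R-compare zero    (suc j) = tri< (zero-S-suc j) 0≢1+n (nothing-S-zero _)
  adjoin-least-compare R-compare (suc i) zero    = tri> (nothing-S-zero _) (0≢1+n ∘ sym) (zero-S-suc i)
  adjoin-least-compare R-compare (suc i) (suc j) with R-compare i j
  ... | tri< iRj i≢j ¬jRi = tri< (R⇔.from i j iRj) (i≢j ∘ suc-injective) (¬jRi ∘ R⇔.to j i)
  ... | tri≈ ¬iRj i≡j ¬jRi = tri≈ (¬iRj ∘ R⇔.to i j) (cong suc i≡j) (¬jRi ∘ R⇔.to j i)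
  ... | tri> ¬iRj i≢j jRi = tri> (¬iRj ∘ R⇔.to i j) (i≢j ∘ suc-injective) (R⇔.from j i jRi)

  adjoin-least : IsStrictTotalOrder _≡_ R → IsStrictTotalOrder _≡_ S
  adjoin-least R-order = isStrictTotalOrderᶜ record
    { isEquivalence = isEquivalence
    ; trans         = adjoin-least-trans R.trans
    ; compare       = adjoin-least-compare R.compare
    }
    where module R = IsStrictTotalOrder R-order

loop-≢-col : {U : Set} {λc : U → U → Colour⁺ n} → IsEdgeColouring U λc → ∀ x i → λc x x ≢ col i
loop-≢-col colouring x i = 0≢1+n ∘ trans (sym (Equivalence.from (identity x x) refl))
  where open IsEdgeColouring colouring

module _ {U : Set} {λc : U → U → Colour⁺ n}
         (colouring : IsEdgeColouring U λc) (rep : IsQualRep U (induced λc))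
         (v₀ : U) (v : Fin n → U) (v₀-v : ∀ i → λc v₀ (v i) ≡ col i) where
  open IsEdgeColouring colouring using (symmetric)

  _◁_ : Rel (Fin n) _
  i ◁ j = λc (v i) (v j) ≡ col j

  ◁⇒≢ : {i j : Fin n} → i ◁ j → i ≢ j
  ◁⇒≢ iRj refl = loop-≢-col colouring _ _ iRj

  ◁-asym : {i j : Fin n} → i ◁ j → ¬ j ◁ i
  ◁-asym iRj jRi = ◁⇒≢ iRj (sym (suc-injective (trans (sym iRj) (trans (symmetric _ _) jRi))))

  ◁-connex : {i j : Fin n} → i ≢ j → i ◁ j ⊎ j ◁ i
  ◁-connex {i} {j} i≢j with λc (v i) (v j) ≟ col j | λc (v i) (v j) ≟ col i
  ... | yes iRj | _        = inj₁ iRj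
  ... | no _    | yes ij≡i = inj₂ (trans (symmetric _ _) ij≡i)
  ... | no ij≢j | no ij≢i  = ⊥-elim (no-rainbow-triangle rep v₀ (v i) (v j)
          (λ e → ij≢i (trans (sym e) (v₀-v i)))
          (λ e → ij≢j (trans e (v₀-v j)))
          (col-≢ (v₀-v i) (v₀-v j) i≢j))

  ◁-trans : Transitive _◁_
  ◁-trans {i} {j} {k} iRj jRk with i ≟ k
  ... | yes refl = ⊥-elim (◁-asym iRj jRk)
  ... | no i≢k with ◁-connex i≢k
  ... | inj₁ iRk = iRk
  ... | inj₂ kRi = ⊥-elim (no-rainbow-triangle rep (v i) (v j) (v k)
          (col-≢ iRj jRk (◁⇒≢ jRk))
          (col-≢ jRk ik≡i (i≢k ∘ sym))
          (col-≢ iRj ik≡i (◁⇒≢ iRj ∘ sym)))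
    where
    ik≡i : λc (v i) (v k) ≡ col i
    ik≡i = trans (symmetric _ _) kRi

  ◁-compare : Trichotomous _≡_ _◁_
  ◁-compare i j with i ≟ j
  ... | yes refl = tri≈ (λ iRi → ◁⇒≢ iRi refl) refl (λ iRi → ◁⇒≢ iRi refl)
  ... | no i≢j with ◁-connex i≢j
  ... | inj₁ iRj = tri< iRj i≢j (◁-asym iRj)
  ... | inj₂ jRi = tri> (λ iRj → ◁-asym iRj jRi) i≢j jRi

  ◁-isStrictTotalOrder : IsStrictTotalOrder _≡_ _◁_
  ◁-isStrictTotalOrder = isStrictTotalOrderᶜ record
    { isEquivalence = isEquivalence
    ; trans         = ◁-trans
    ; compare       = ◁-compare
    }

lemma14 : (n : ℕ) → 1 ≤ n → (B : Set) → (λc : B → B → Colour⁺ n) →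
          IsEdgeColouring B λc → IsQualRep B (induced λc) →
          (v₀ : B) → Saturated λc v₀ →
          (v : Fin n → B) → (∀ i → λc v₀ (v i) ≡ col i) →
          IsStrictTotalOrder _≡_ (Sq λc (family v₀ v))
lemma14 n _ B λc colouring rep v₀ _ v v₀-v =
  adjoin-least (λ _ ()) v₀-v (λ _ _ → mk⇔ id id) (◁-isStrictTotalOrder colouring rep v₀ v v₀-v)
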